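{- Let $G$ be a locally finite graph, let $\{f_n\}_{n\ge1}$ be a non-decreasing sequence of non-negative integers, let $r$ be a positive integer, and define $g_{n+1}=\sum_{i=1}^r f_{rn+i}$ for $n\ge 0$. Then $G$ has the $(\{f_n\},1)$-containment property if and only if $G$ has the $(\{g_n\},r)$-containment property.
   Context: Let $G$ be a graph, $r$ a positive integer and $\{f_n\}_{n\ge1}$ a sequence of non-negative integers. Given a finite set $X_0$ of vertices (the initial fire), a sequence $\{W_k\}_{k\geq1}$ of vertex sets is an $(\{f_n\},r)$-containment strategy for $X_0$ if: (1) $|W_n|\le f_n$ for all $n\ge1$; (2) $X_n\cap W_{n+1}=\emptyset$ for all $n\ge 0$, where for $n>0$, $X_n$ is the set of vertices connected to a vertex of $X_{n-1}$ by a path of length at most $r$ containing no vertex of $W_1\cup\cdots\cup W_n$; (3) there is $N>0$ with $X_n=X_N$ for all $n\ge N$. $G$ has the $(\{f_n\},r)$-containment property if every finite set of vertices admits an $(\{f_n\},r)$-containment strategy. Locally finite means every vertex has finite degree. -}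

module Defs where

open import Data.Nat using (ℕ; zero; suc; _+_; _*_; _≤_)
open import Data.List using (List; length)
open import Data.List.Membership.Propositional using (_∈_)
open import Data.Product using (Σ; _×_)
open import Relation.Nullary using (¬_)

record Graph : Set₁ where
  field
    V       : Set
    Adj     : V → V → Set
    Adj-sym : ∀ {u v} → Adj u v → Adj v u
    Adj-irr : ∀ {v} → ¬ Adj v v
open Graph public

LocallyFinite : Graph → Set
LocallyFinite G = (v : V G) → Σ (List (V G)) λ L → ∀ u → Adj G v u → u ∈ L

-- Sequences {f_n}_{n≥1} are functions ℕ → ℕ; the value at 0 is ignored.
NonDecreasing : (ℕ → ℕ) → Set
NonDecreasing f = ∀ m n → 1 ≤ m → m ≤ n → f m ≤ f n

sum1 : (ℕ → ℕ) → ℕ → ℕ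
sum1 h zero    = 0
sum1 h (suc k) = sum1 h k + h (suc k)

-- g_{n+1} = Σ_{i=1}^{r} f_{rn+i}  (g 0 is an unused dummy value)
gSeq : (ℕ → ℕ) → ℕ → ℕ → ℕ
gSeq f r zero    = 0
gSeq f r (suc n) = sum1 (λ i → f (r * n + i)) r

module _ (G : Graph) where
  data WalkAvoid (B : V G → Set) : ℕ → V G → V G → Set where
    stay : ∀ {v} → ¬ B v → WalkAvoid B 0 v v
    step : ∀ {k u w v} → ¬ B u → Adj G u w → WalkAvoid B k w v → WalkAvoid B (suc k) u v

  Protected : (ℕ → List (V G)) → ℕ → V G → Set
  Protected W k w = Σ ℕ λ i → 1 ≤ i × i ≤ k × w ∈ W i

  Fire : (W : ℕ → List (V G)) (r : ℕ) (X0 : List (V G)) → ℕ → V G → Set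
  Fire W r X0 zero    v = v ∈ X0
  Fire W r X0 (suc n) v =
    Σ (V G) λ u → Fire W r X0 n u ×
      Σ ℕ λ k → k ≤ r × WalkAvoid (Protected W (suc n)) k u v

  IsContainmentStrategy : (f : ℕ → ℕ) (r : ℕ) (X0 : List (V G)) (W : ℕ → List (V G)) → Set
  IsContainmentStrategy f r X0 W =
    (∀ n → 1 ≤ n → length (W n) ≤ f n)
    × (∀ n v → Fire W r X0 n v → ¬ (v ∈ W (suc n)))
    × (Σ ℕ λ N → 1 ≤ N × ∀ n → N ≤ n → ∀ v →
         (Fire W r X0 n v → Fire W r X0 N v) × (Fire W r X0 N v → Fire W r X0 n v))

  ContainmentProperty : (f : ℕ → ℕ) (r : ℕ) → Set
  ContainmentProperty f r =
    (X0 : List (V G)) → Σ (ℕ → List (V G)) λ W → IsContainmentStrategy f r X0 W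

module Submission where

-- A round of the radius-r game is r rounds of the radius-1 game played at once. From a radius-1
-- strategy, defending in round n + 1 everything defended in rounds r n + 1, …, r n + r gives a
-- radius-r strategy whose fire at round n stays inside the radius-1 fire at time r n. Conversely, the
-- radius-r defence of round q + 1 is cut into r pieces of sizes f (r q + 1), …, f (r q + r), played in
-- successive radius-1 rounds one radius-r round late (monotonicity of f pays for the delay); the
-- radius-1 fire then stays inside the radius-r fire. In both directions the new fire is confined to
-- the fire of a strategy, which in a locally finite graph lies in a finite ball, and a growing fire
-- confined to a finite set of size L no longer changes after time L.

open import Defs
open import Data.Nat
  using (ℕ; zero; suc; _+_; _*_; _∸_; _≤_; _<_; _≤′_; ≤′-refl; ≤′-step; s≤s; z≤n; NonZero)
open import Data.Nat.Properties
open import Data.Nat.DivMod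
  using (_/_; _%_; m≡m%n+[m/n]*n; m%n<n; m<n*o⇒m/o<n; [m+kn]%n≡m%n; m<n⇒m%n≡m)
open import Data.List using (List; []; _∷_; _++_; length; concatMap; lookup; take; drop)
open import Data.List.Properties using (length-++; length-take; take-[]; take-all; take++drop≡id)
open import Data.List.Membership.Propositional using (_∈_; _∉_)
open import Data.List.Membership.Propositional.Properties
  using (∈-++⁺ˡ; ∈-++⁺ʳ; ∈-++⁻; ∈-concatMap⁺; ∈-lookup)
import Data.List.Membership.DecPropositional as DecMembership
open import Data.List.Relation.Unary.All as All using ([])
open import Data.List.Relation.Unary.All.Properties using (¬Any⇒All¬)
open import Data.List.Relation.Unary.Any as Any using (here; there; index)
open import Data.List.Relation.Unary.Any.Properties using (lookup-index)
open import Data.List.Relation.Unary.AllPairs using ([]; _∷_)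
open import Data.List.Relation.Unary.Unique.Propositional using (Unique)
open import Data.Fin as Fin using (Fin)
open import Data.Fin.Properties using (pigeonhole) renaming (_≟_ to _≟ᶠ_)
open import Data.Product using (Σ; _×_; _,_; proj₁; proj₂)
open import Data.Sum using (inj₁; inj₂)
open import Relation.Nullary using (¬_; yes; no)
open import Relation.Unary using (_⊆_)
open import Relation.Binary.PropositionalEquality

lookup-distinct : ∀ {A : Set} {xs : List A} → Unique xs →
                  ∀ {i j} → i Fin.< j → lookup xs i ≢ lookup xs j
lookup-distinct (x∉xs ∷ _)  {Fin.zero}  {Fin.suc j} _         = All.lookup x∉xs (∈-lookup j)
lookup-distinct (_ ∷ uniq) {Fin.suc i} {Fin.suc j} (s≤s i<j) = lookup-distinct uniq i<j

length-unique-≤ : ∀ {n} {ps : List (Fin n)} → Unique ps → length ps ≤ n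
length-unique-≤ {ps = ps} uniq = ≮⇒≥ λ n<length →
  let (i , j , i<j , same) = pigeonhole n<length (lookup ps) in lookup-distinct uniq i<j same

m≡n*[m/n]+m%n : ∀ m n .{{_ : NonZero n}} → m ≡ n * (m / n) + m % n
m≡n*[m/n]+m%n m n =
  trans (m≡m%n+[m/n]*n m n) (trans (+-comm (m % n) _) (cong (_+ m % n) (*-comm (m / n) n)))

/-%-unique : ∀ r .{{_ : NonZero r}} q {p} → p < r → (r * q + p) / r ≡ q × (r * q + p) % r ≡ p
/-%-unique r q {p} p<r = quotient , remainder
  where
  open ≡-Reasoning
  remainder : (r * q + p) % r ≡ p
  remainder = begin
    (r * q + p) % r ≡⟨ cong (_% r) (trans (+-comm (r * q) p) (cong (p +_) (*-comm r q))) ⟩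
    (p + q * r) % r ≡⟨ [m+kn]%n≡m%n p q r ⟩
    p % r           ≡⟨ m<n⇒m%n≡m p<r ⟩
    p               ∎
  quotient : (r * q + p) / r ≡ q
  quotient = *-cancelˡ-≡ _ q r (+-cancelʳ-≡ p _ _ (begin
    r * ((r * q + p) / r) + p               ≡⟨ cong (r * ((r * q + p) / r) +_) (sym remainder) ⟩
    r * ((r * q + p) / r) + (r * q + p) % r ≡⟨ sym (m≡n*[m/n]+m%n (r * q + p) r) ⟩
    r * q + p                               ∎))

module _ {A : Set} where

  block : (ℕ → List A) → ℕ → ℕ → List A
  block W s zero    = []
  block W s (suc k) = block W s k ++ W (s + suc k)

  length-block : ∀ {W : ℕ → List A} {f : ℕ → ℕ} → (∀ i → 1 ≤ i → length (W i) ≤ f i) →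
                 ∀ s k → length (block W s k) ≤ sum1 (λ i → f (s + i)) k
  length-block bounded s zero    = z≤n
  length-block {W} bounded s (suc k) = begin
    length (block W s k ++ W (s + suc k))         ≡⟨ length-++ (block W s k) ⟩
    length (block W s k) + length (W (s + suc k)) ≤⟨ +-mono-≤ (length-block bounded s k)
                                                              (bounded _ 1≤s+1+k) ⟩
    _                                             ∎
    where
    open ≤-Reasoning
    1≤s+1+k = ≤-trans (s≤s z≤n) (m≤n+m (suc k) s)

  ∈-block⁻ : ∀ {W : ℕ → List A} {w} s k → w ∈ block W s k →
             Σ ℕ λ i → 1 ≤ i × i ≤ k × w ∈ W (s + i)
  ∈-block⁻ {W} s (suc k) w∈ with ∈-++⁻ (block W s k) w∈
  ... | inj₁ w∈block = let (i , 1≤i , i≤k , w∈W) = ∈-block⁻ s k w∈block in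
                       i , 1≤i , m≤n⇒m≤1+n i≤k , w∈W
  ... | inj₂ w∈W     = suc k , s≤s z≤n , ≤-refl , w∈W

  ∈-block⁺ : ∀ {W : ℕ → List A} {w} s k {i} → 1 ≤ i → i ≤ k → w ∈ W (s + i) → w ∈ block W s k
  ∈-block⁺ s zero {suc i} _ () _
  ∈-block⁺ {W} s (suc k) 1≤i i≤1+k w∈W with m≤n⇒m<n∨m≡n i≤1+k
  ... | inj₁ (s≤s i≤k) = ∈-++⁺ˡ (∈-block⁺ s k 1≤i i≤k w∈W)
  ... | inj₂ refl      = ∈-++⁺ʳ (block W s k) w∈W

  ∈-take⁻ : ∀ n {x : A} {xs} → x ∈ take n xs → x ∈ xs
  ∈-take⁻ n {xs = xs} x∈ = subst (_ ∈_) (take++drop≡id n xs) (∈-++⁺ˡ x∈)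

  ∈-drop⁻ : ∀ n {x : A} {xs} → x ∈ drop n xs → x ∈ xs
  ∈-drop⁻ n {xs = xs} x∈ = subst (_ ∈_) (take++drop≡id n xs) (∈-++⁺ʳ (take n xs) x∈)

  take-+ : ∀ m n (xs : List A) → take (m + n) xs ≡ take m xs ++ take n (drop m xs)
  take-+ zero    n xs       = refl
  take-+ (suc m) n []       = sym (cong (_++_ []) (take-[] n))
  take-+ (suc m) n (x ∷ xs) = cong (x ∷_) (take-+ m n xs)

  -- chunk h xs p is the (p + 1)-st piece when xs is cut into consecutive pieces of lengths h 1, h 2, …
  chunk : (ℕ → ℕ) → List A → ℕ → List A
  chunk h xs p = take (h (suc p)) (drop (sum1 h p) xs)

  ∈-chunk⁻ : ∀ h {xs : List A} p {x} → x ∈ chunk h xs p → x ∈ xs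
  ∈-chunk⁻ h p x∈ = ∈-drop⁻ (sum1 h p) (∈-take⁻ (h (suc p)) x∈)

  length-chunk : ∀ h (xs : List A) p → length (chunk h xs p) ≤ h (suc p)
  length-chunk h xs p = ≤-trans (≤-reflexive (length-take (h (suc p)) _)) (m⊓n≤m _ _)

  ∈-chunk⁺ : ∀ h {xs : List A} k {x} → x ∈ xs → length xs ≤ sum1 h k →
             Σ ℕ λ p → p < k × x ∈ chunk h xs p
  ∈-chunk⁺ h {xs} k x∈ short = pieces k (subst (_ ∈_) (sym (take-all (sum1 h k) xs short)) x∈)
    where
    pieces : ∀ k {x} → x ∈ take (sum1 h k) xs → Σ ℕ λ p → p < k × x ∈ chunk h xs p
    pieces (suc k) x∈
      with ∈-++⁻ (take (sum1 h k) xs) (subst (_ ∈_) (take-+ (sum1 h k) (h (suc k)) xs) x∈)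
    ... | inj₁ x∈front = let (p , p<k , x∈chunk) = pieces k x∈front in
                         p , m<n⇒m<1+n p<k , x∈chunk
    ... | inj₂ x∈last  = k , ≤-refl , x∈last

module _ (G : Graph) where

  walk-target-free : ∀ {B k u v} → WalkAvoid G B k u v → ¬ B v
  walk-target-free (stay ¬Bv)      = ¬Bv
  walk-target-free (step _ _ walk) = walk-target-free walk

  walk-source-free : ∀ {B k u v} → WalkAvoid G B k u v → ¬ B u
  walk-source-free (stay ¬Bu)     = ¬Bu
  walk-source-free (step ¬Bu _ _) = ¬Bu

  walk-weaken : ∀ {B B′} → B′ ⊆ B → ∀ {k u v} → WalkAvoid G B k u v → WalkAvoid G B′ k u v
  walk-weaken B′⊆B (stay ¬Bv)        = stay (λ B′v → ¬Bv (B′⊆B B′v))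
  walk-weaken B′⊆B (step ¬Bu uw walk) =
    step (λ B′u → ¬Bu (B′⊆B B′u)) uw (walk-weaken B′⊆B walk)

  walk-++ : ∀ {B k l u w v} → WalkAvoid G B k u w → WalkAvoid G B l w v → WalkAvoid G B (k + l) u v
  walk-++ (stay _)           rest = rest
  walk-++ (step ¬Bu uw walk) rest = step ¬Bu uw (walk-++ walk rest)

  protected-mono : ∀ W {m n} → m ≤ n → Protected G W m ⊆ Protected G W n
  protected-mono W m≤n (i , 1≤i , i≤m , w∈W) = i , 1≤i , ≤-trans i≤m m≤n , w∈W

  Spreads : (ℕ → List (V G)) → ℕ → ℕ → V G → V G → Set
  Spreads W r n u v = Σ ℕ λ k → k ≤ r × WalkAvoid G (Protected G W n) k u v

  AvoidsFire : (ℕ → List (V G)) → ℕ → List (V G) → Set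
  AvoidsFire W r X0 = ∀ n v → Fire G W r X0 n v → ¬ (v ∈ W (suc n))

  Stabilises : (ℕ → V G → Set) → Set
  Stabilises X = Σ ℕ λ N → 1 ≤ N × ∀ n → N ≤ n → ∀ v → (X n v → X N v) × (X N v → X n v)

  module Game (W : ℕ → List (V G)) (r : ℕ) (X0 : List (V G)) where

    X : ℕ → V G → Set
    X = Fire G W r X0

    fire-unprotected : ∀ n {v} → X n v → ¬ Protected G W n v
    fire-unprotected zero    _ (i , 1≤i , i≤0 , _) = <⇒≱ 1≤i i≤0
    fire-unprotected (suc n) (_ , _ , _ , _ , walk) = walk-target-free walk

    spreads-earlier : ∀ {m n u v} → m ≤ n → Spreads W r n u v → Spreads W r m u v
    spreads-earlier m≤n (k , k≤r , walk) = k , k≤r , walk-weaken (protected-mono W m≤n) walk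

    module _ (avoids : AvoidsFire W r X0) where

      fire-unprotected-next : ∀ n {v} → X n v → ¬ Protected G W (suc n) v
      fire-unprotected-next n x (i , 1≤i , i≤1+n , v∈W) with m≤n⇒m<n∨m≡n i≤1+n
      ... | inj₁ (s≤s i≤n) = fire-unprotected n x (i , 1≤i , i≤n , v∈W)
      ... | inj₂ refl      = avoids n _ x v∈W

      fire-suc : ∀ {n v} → X n v → X (suc n) v
      fire-suc {n} {v} x = v , x , 0 , z≤n , stay (fire-unprotected-next n x)

      fire-mono : ∀ {m n} → m ≤ n → X m ⊆ X n
      fire-mono m≤n = go (≤⇒≤′ m≤n)
        where
        go : ∀ {m n} → m ≤′ n → X m ⊆ X n
        go ≤′-refl        x = x
        go (≤′-step m≤′n) x = fire-suc (go m≤′n x)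

      -- A fire confined to a finite list K burns out by time |K|: every burning vertex is reached by a
      -- chain of burning vertices with distinct positions in K, one per time step. The fire is not
      -- decidable, so |K| cannot simply bound the number of times it grows.
      module Confined (K : List (V G)) (confined : ∀ n → X n ⊆ (_∈ K)) where

        private
          L = length K
          open DecMembership (_≟ᶠ_ {L}) using (_∈?_)

        data Chain : ℕ → Fin L → List (Fin L) → Set where
          start  : ∀ {p} → lookup K p ∈ X0 → Chain 0 p (p ∷ [])
          extend : ∀ {t p q ps} → Chain t q ps → Spreads W r (suc t) (lookup K q) (lookup K p) →
                   p ∉ ps → Chain (suc t) p (p ∷ ps)

        ChainWithin : ℕ → Fin L → Set
        ChainWithin t p = Σ ℕ λ s → s ≤ t × Σ (List (Fin L)) (Chain s p)

        chain-fire : ∀ {t p ps} → Chain t p ps → X t (lookup K p)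
        chain-fire (start x)               = x
        chain-fire (extend chain spread _) = _ , chain-fire chain , spread

        chain-unique : ∀ {t p ps} → Chain t p ps → Unique ps
        chain-unique (start _)             = [] ∷ []
        chain-unique (extend chain _ p∉ps) = ¬Any⇒All¬ _ p∉ps ∷ chain-unique chain

        chain-length : ∀ {t p ps} → Chain t p ps → length ps ≡ suc t
        chain-length (start _)          = refl
        chain-length (extend chain _ _) = cong suc (chain-length chain)

        chain-time<L : ∀ {t p ps} → Chain t p ps → t < L
        chain-time<L chain = subst (_≤ L) (chain-length chain) (length-unique-≤ (chain-unique chain))

        within-mono : ∀ {t t′ p} → t ≤ t′ → ChainWithin t p → ChainWithin t′ p
        within-mono t≤t′ (s , s≤t , ps , chain) = s , ≤-trans s≤t t≤t′ , ps , chain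

        chain-member : ∀ {t p ps q} → Chain t p ps → q ∈ ps → ChainWithin t q
        chain-member chain@(start _)      (here refl)  = _ , ≤-refl , _ , chain
        chain-member chain@(extend _ _ _) (here refl)  = _ , ≤-refl , _ , chain
        chain-member (start _)            (there ())
        chain-member (extend chain _ _)   (there q∈ps) = within-mono (n≤1+n _) (chain-member chain q∈ps)

        -- if p already occurs in the chain, its vertex burnt earlier: keep that shorter chain
        within-extend : ∀ {t p q} → ChainWithin t q → Spreads W r (suc t) (lookup K q) (lookup K p) →
                        ChainWithin (suc t) p
        within-extend {p = p} (s , s≤t , ps , chain) spread with p ∈? ps
        ... | yes p∈ps = within-mono (m≤n⇒m≤1+n s≤t) (chain-member chain p∈ps)
        ... | no  p∉ps =
          suc s , s≤s s≤t , p ∷ ps , extend chain (spreads-earlier (s≤s s≤t) spread) p∉ps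

        position : ∀ n {v} → X n v → Σ (Fin L) λ p → lookup K p ≡ v
        position n x = index v∈K , sym (lookup-index v∈K)
          where v∈K = confined n x

        fire⇒chain : ∀ t {p} → X t (lookup K p) → ChainWithin t p
        fire⇒chain zero    x = 0 , z≤n , _ , start x
        fire⇒chain (suc t) {p} (u , xu , spread) =
          let (q , q↦u) = position t xu in
          within-extend (fire⇒chain t (subst (X t) (sym q↦u) xu))
                        (subst (λ w → Spreads W r (suc t) w (lookup K p)) (sym q↦u) spread)

        fire-settles : ∀ t {v} → X t v → X L v
        fire-settles t x =
          let (p , p↦v)           = position t x
              (s , _ , _ , chain) = fire⇒chain t (subst (X t) (sym p↦v) x)
          in subst (X L) p↦v (fire-mono (<⇒≤ (chain-time<L chain)) (chain-fire chain))

        stabilises : Stabilises X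
        stabilises = suc L , s≤s z≤n ,
                     λ n L<n v → (λ x → fire-suc (fire-settles n x)) , fire-mono L<n

  module Balls (lf : LocallyFinite G) where

    neighbours : V G → List (V G)
    neighbours v = proj₁ (lf v)

    expand : List (V G) → List (V G)
    expand xs = xs ++ concatMap neighbours xs

    ball : ℕ → List (V G) → List (V G)
    ball zero    xs = xs
    ball (suc k) xs = ball k (expand xs)

    ∈-expand : ∀ {xs u v} → u ∈ xs → Adj G u v → v ∈ expand xs
    ∈-expand {xs} u∈xs uv =
      ∈-++⁺ʳ xs (∈-concatMap⁺ neighbours (Any.map (λ { refl → proj₂ (lf _) _ uv }) u∈xs))

    ball-⊇ : ∀ k {xs x} → x ∈ xs → x ∈ ball k xs
    ball-⊇ zero    x∈xs = x∈xs
    ball-⊇ (suc k) x∈xs = ball-⊇ k (∈-++⁺ˡ x∈xs)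

    ball-+ : ∀ m n xs → ball m (ball n xs) ≡ ball (n + m) xs
    ball-+ m zero    xs = refl
    ball-+ m (suc n) xs = ball-+ m n (expand xs)

    ball-mono : ∀ {m n} → m ≤ n → ∀ {xs x} → x ∈ ball m xs → x ∈ ball n xs
    ball-mono {m} {n} m≤n {xs} x∈ =
      subst (λ k → _ ∈ ball k xs) (m+[n∸m]≡n m≤n)
        (subst (_ ∈_) (ball-+ (n ∸ m) m xs) (ball-⊇ (n ∸ m) x∈))

    walk∈ball : ∀ {B k u v xs} → u ∈ xs → WalkAvoid G B k u v → v ∈ ball k xs
    walk∈ball u∈xs (stay _)         = u∈xs
    walk∈ball u∈xs (step _ uw walk) = walk∈ball (∈-expand u∈xs uw) walk

    fire∈ball : ∀ {W r X0} n {v} → Fire G W r X0 n v → v ∈ ball (n * r) X0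
    fire∈ball zero x = x
    fire∈ball {r = r} {X0} (suc n) {v} (u , xu , k , k≤r , walk) =
      subst (λ m → v ∈ ball m X0) (+-comm (n * r) r)
        (subst (v ∈_) (ball-+ r (n * r) X0) (ball-mono k≤r (walk∈ball (fire∈ball n xu) walk)))

    strategy-fire-finite : ∀ {f r X0 W} → IsContainmentStrategy G f r X0 W →
                           Σ (List (V G)) λ K → ∀ n → Fire G W r X0 n ⊆ (_∈ K)
    strategy-fire-finite {r = r} {X0} {W} (_ , avoids , N , _ , stable) =
      ball (N * r) X0 , fire∈ball-N
      where
      fire∈ball-N : ∀ n → Fire G W r X0 n ⊆ (_∈ ball (N * r) X0)
      fire∈ball-N n x with ≤-total n N
      ... | inj₁ n≤N = fire∈ball N (Game.fire-mono W r X0 avoids n≤N x)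
      ... | inj₂ N≤n = fire∈ball N (proj₁ (stable n N≤n _) x)

    stabilises-inside-strategy : ∀ {W r X0 f′ r′ Y0 W′} →
                                 AvoidsFire W r X0 → IsContainmentStrategy G f′ r′ Y0 W′ →
                                 (∀ n {v} → Fire G W r X0 n v → Σ ℕ λ m → Fire G W′ r′ Y0 m v) →
                                 Stabilises (Fire G W r X0)
    stabilises-inside-strategy {W} {r} {X0} avoids strategy inside =
      let (K , confined) = strategy-fire-finite strategy in
      Game.Confined.stabilises W r X0 avoids K (λ n x → let (m , y) = inside n x in confined m y)

  module RadiusOne (W : ℕ → List (V G)) (X0 : List (V G)) where
    open Game W 1 X0 using (X; fire-unprotected)

    walk⇒fire : ∀ {B k} s {u v} → X s u → WalkAvoid G B k u v → Protected G W (s + k) ⊆ B →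
                X (s + k) v
    walk⇒fire s {v = v} x (stay _) _ = subst (λ t → X t v) (sym (+-identityʳ s)) x
    walk⇒fire {B} {suc k} s {u} {v} x (step ¬Bu uw walk) P⊆B =
      subst (λ t → X t v) (sym (+-suc s k)) (walk⇒fire (suc s) next walk P⊆B′)
      where
      P⊆B′ : Protected G W (suc s + k) ⊆ B
      P⊆B′ = subst (λ t → Protected G W t ⊆ B) (+-suc s k) P⊆B
      early : Protected G W (suc s) ⊆ B
      early = λ p → P⊆B′ (protected-mono W (m≤m+n (suc s) k) p)
      next : X (suc s) _
      next = u , x , 1 , ≤-refl ,
             step (λ p → ¬Bu (early p)) uw (stay (λ p → walk-source-free walk (early p)))

    fire⇒walk : ∀ {B} s j {v} → B ⊆ Protected G W s → X (s + j) v →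
                Σ (V G) λ u → X s u × Σ ℕ λ k → k ≤ j × WalkAvoid G B k u v
    fire⇒walk s zero {v} B⊆P x =
      v , xv , 0 , z≤n , stay (λ Bv → fire-unprotected s xv (B⊆P Bv))
      where xv = subst (λ t → X t v) (+-identityʳ s) x
    fire⇒walk s (suc j) {v} B⊆P x with subst (λ t → X t v) (+-suc s j) x
    ... | w , xw , k′ , k′≤1 , last with fire⇒walk s j B⊆P xw
    ...   | u , xu , k , k≤j , walk =
      u , xu , k + k′ , ≤-trans (+-mono-≤ k≤j k′≤1) (≤-reflexive (+-comm j 1)) ,
      walk-++ walk (walk-weaken (λ Bw → protected-mono W (m≤n⇒m≤1+n (m≤m+n s j)) (B⊆P Bw)) last)

  module Merge (lf : LocallyFinite G) {f : ℕ → ℕ} (r : ℕ) .{{_ : NonZero r}} {X0 : List (V G)}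
               {W : ℕ → List (V G)} (strategy : IsContainmentStrategy G f 1 X0 W) where

    open Game W 1 X0 using (X)
    open RadiusOne W X0 using (walk⇒fire)

    private
      bounded : ∀ n → 1 ≤ n → length (W n) ≤ f n
      bounded = proj₁ strategy
      avoids : AvoidsFire W 1 X0
      avoids = proj₁ (proj₂ strategy)
      fire-mono : ∀ {m n} → m ≤ n → X m ⊆ X n
      fire-mono = Game.fire-mono W 1 X0 avoids

    W′ : ℕ → List (V G)
    W′ zero    = []
    W′ (suc n) = block W (r * n) r

    protected-merged : ∀ n {m} → m ≤ r * suc n → Protected G W m ⊆ Protected G W′ (suc n)
    protected-merged n m≤ (zero  , ()  , _ , _)
    protected-merged n m≤ {w} (suc i , _ , 1+i≤m , w∈W) =
      suc q , s≤s z≤n , s≤s q≤n ,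
      ∈-block⁺ (r * q) r (s≤s z≤n) (m%n<n i r) (subst (λ t → w ∈ W t) split w∈W)
      where
      q = i / r
      split : suc i ≡ r * q + suc (i % r)
      split = trans (cong suc (m≡n*[m/n]+m%n i r)) (sym (+-suc (r * q) (i % r)))
      q≤n : q ≤ n
      q≤n = ≤-pred (m<n*o⇒m/o<n (≤-trans 1+i≤m (≤-trans m≤ (≤-reflexive (*-comm r (suc n))))))

    fire′⊆fire : ∀ n → Fire G W′ r X0 n ⊆ X (r * n)
    fire′⊆fire zero {v} x = subst (λ t → X t v) (sym (*-zeroʳ r)) x
    fire′⊆fire (suc n) (u , xu , k , k≤r , walk) =
      fire-mono within-round
        (walk⇒fire (r * n) (fire′⊆fire n xu) walk (protected-merged n within-round))
      where
      within-round : r * n + k ≤ r * suc n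
      within-round =
        ≤-trans (+-monoʳ-≤ (r * n) k≤r) (≤-reflexive (trans (+-comm (r * n) r) (sym (*-suc r n))))

    merged-avoids : AvoidsFire W′ r X0
    merged-avoids n v x v∈W′ with ∈-block⁻ (r * n) r v∈W′
    ... | suc i , _ , _ , v∈W =
      avoids (r * n + i) v (fire-mono (m≤m+n (r * n) i) (fire′⊆fire n x))
        (subst (λ t → v ∈ W t) (+-suc (r * n) i) v∈W)

    merged-strategy : IsContainmentStrategy G (gSeq f r) r X0 W′
    merged-strategy =
      (λ { (suc n) _ → length-block bounded (r * n) r }) ,
      merged-avoids ,
      Balls.stabilises-inside-strategy lf merged-avoids strategy (λ n x → r * n , fire′⊆fire n x)

  -- Nothing is defended in the first r rounds of the radius-1 game, which is why the radius-r game
  -- starts from the ball of radius 2r around X0.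
  module Split (lf : LocallyFinite G) {f : ℕ → ℕ} (f-mono : NonDecreasing f)
               (r : ℕ) .{{_ : NonZero r}} (X0 : List (V G)) {W′ : ℕ → List (V G)}
               (strategy : IsContainmentStrategy G (gSeq f r) r (Balls.ball lf (r + r) X0) W′) where

    open Balls lf using (ball; ball-mono; fire∈ball)

    piece : ℕ → ℕ → List (V G)
    piece zero    p = []
    piece (suc q) p = chunk (λ i → f (r * q + i)) (W′ (suc q)) p

    W : ℕ → List (V G)
    W zero    = []
    W (suc t) = piece (t / r) (t % r)

    open Game W 1 X0 using (X)
    open RadiusOne W X0 using (fire⇒walk)

    private
      X′ : ℕ → V G → Set
      X′ = Fire G W′ r (ball (r + r) X0)
      bounded′ : ∀ n → 1 ≤ n → length (W′ n) ≤ gSeq f r n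
      bounded′ = proj₁ strategy
      avoids′ : AvoidsFire W′ r (ball (r + r) X0)
      avoids′ = proj₁ (proj₂ strategy)

    W-piece : ∀ q {p} → p < r → W (suc (r * q + p)) ≡ piece q p
    W-piece q p<r = let (quotient , remainder) = /-%-unique r q p<r in cong₂ piece quotient remainder

    protected-split : ∀ m → Protected G W′ (suc m) ⊆ Protected G W (r * suc (suc m))
    protected-split m (zero , () , _)
    protected-split m {w} (suc q , _ , s≤s q≤m , w∈W′)
      with ∈-chunk⁺ (λ i → f (r * q + i)) r w∈W′ (bounded′ (suc q) (s≤s z≤n))
    ... | p , p<r , w∈piece =
      suc (r * suc q + p) , s≤s z≤n , played-in-time ,
      subst (w ∈_) (sym (W-piece (suc q) p<r)) w∈piece
      where
      open ≤-Reasoning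
      played-in-time : suc (r * suc q + p) ≤ r * suc (suc m)
      played-in-time = begin
        suc (r * suc q + p) ≡⟨ sym (+-suc (r * suc q) p) ⟩
        r * suc q + suc p   ≤⟨ +-monoʳ-≤ (r * suc q) p<r ⟩
        r * suc q + r       ≡⟨ trans (+-comm (r * suc q) r) (sym (*-suc r (suc q))) ⟩
        r * suc (suc q)     ≤⟨ *-monoʳ-≤ r (s≤s (s≤s q≤m)) ⟩
        r * suc (suc m)     ∎

    fire⊆fire′-lagged : ∀ m j → j ≤ r → X (r * suc m + j) ⊆ X′ m
    fire⊆fire′-lagged zero j j≤r x = ball-mono head-start (fire∈ball (r * 1 + j) x)
      where
      head-start : (r * 1 + j) * 1 ≤ r + r
      head-start =
        ≤-trans (≤-reflexive (trans (*-identityʳ _) (cong (_+ j) (*-identityʳ r)))) (+-monoʳ-≤ r j≤r)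
    fire⊆fire′-lagged (suc m) j j≤r x with fire⇒walk (r * suc (suc m)) j (protected-split m) x
    ... | u , xu , k , k≤j , walk =
      u , fire⊆fire′-lagged m r ≤-refl (subst (λ t → X t u) round-end xu) ,
      k , ≤-trans k≤j j≤r , walk
      where
      round-end : r * suc (suc m) ≡ r * suc m + r
      round-end = trans (*-suc r (suc m)) (+-comm r (r * suc m))

    split-avoids : AvoidsFire W 1 X0
    split-avoids t v x = avoid (t / r) (t % r) (m%n<n t r) (m≡n*[m/n]+m%n t r)
      where
      avoid : ∀ q p → p < r → t ≡ r * q + p → ¬ (v ∈ piece q p)
      avoid zero    p _   _  ()
      avoid (suc q) p p<r t≡ v∈piece =
        avoids′ q v (fire⊆fire′-lagged q p (<⇒≤ p<r) (subst (λ s → X s v) t≡ x))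
          (∈-chunk⁻ _ p v∈piece)

    split-bounded : ∀ t → 1 ≤ t → length (W t) ≤ f t
    split-bounded (suc t) _ = bound (t / r) (t % r) (m≡n*[m/n]+m%n t r)
      where
      bound : ∀ q p → t ≡ r * q + p → length (piece q p) ≤ f (suc t)
      bound zero    p _  = z≤n
      bound (suc q) p t≡ =
        ≤-trans (length-chunk (λ i → f (r * q + i)) (W′ (suc q)) p) (f-mono _ _ positive early)
        where
        open ≤-Reasoning
        positive : 1 ≤ r * q + suc p
        positive = ≤-trans (s≤s z≤n) (m≤n+m (suc p) (r * q))
        early : r * q + suc p ≤ suc t
        early = begin
          r * q + suc p       ≡⟨ +-suc (r * q) p ⟩
          suc (r * q + p)     ≤⟨ s≤s (+-monoˡ-≤ p (*-monoʳ-≤ r (n≤1+n q))) ⟩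
          suc (r * suc q + p) ≡⟨ cong suc (sym t≡) ⟩
          suc t               ∎

    fire⊆fire′ : ∀ t → X t ⊆ X′ t
    fire⊆fire′ t x = fire⊆fire′-lagged t 0 z≤n (Game.fire-mono W 1 X0 split-avoids later x)
      where
      later : t ≤ r * suc t + 0
      later = ≤-trans (n≤1+n t) (≤-trans (m≤n*m (suc t) r) (m≤m+n (r * suc t) 0))

    split-strategy : IsContainmentStrategy G f 1 X0 W
    split-strategy =
      split-bounded ,
      split-avoids ,
      Balls.stabilises-inside-strategy lf split-avoids strategy (λ t x → t , fire⊆fire′ t x)

proposition1p7 : (G : Graph) → LocallyFinite G → (f : ℕ → ℕ) → NonDecreasing f →
    (r : ℕ) → 1 ≤ r →
    (ContainmentProperty G f 1 → ContainmentProperty G (gSeq f r) r)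
    × (ContainmentProperty G (gSeq f r) r → ContainmentProperty G f 1)
proposition1p7 G lf f f-mono r@(suc _) _ = merge , split
  where
  merge : ContainmentProperty G f 1 → ContainmentProperty G (gSeq f r) r
  merge contain X0 =
    let (_ , strategy) = contain X0 in
    Merge.W′ G lf r strategy , Merge.merged-strategy G lf r strategy

  split : ContainmentProperty G (gSeq f r) r → ContainmentProperty G f 1
  split contain X0 =
    let (_ , strategy) = contain (Balls.ball G lf (r + r) X0) in
    Split.W G lf f-mono r X0 strategy , Split.split-strategy G lf f-mono r X0 strategy
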